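{- Let $n\geq k$ be integers. (i) If $k\geq 4$ and $1\leq t\leq k-2$, then $$F_{n+k-1}^{(k)}=\sum_{j=1}^{k-(t+2)}jF_{n+k-2-j}^{(k)}+(k-t)\sum_{s=0}^{t-1}F_{n+s}^{(k)}+\sum_{i=1}^{k-t}(k-i-t+1)F_{n-i}^{(k)}.$$ (ii) If $k\geq 2$, then $$\sum_{i=1}^{k}iF_{n-i}^{(k)}=(2k-1)F_{n}^{(k)}-F_{n+k-1}^{(k)}+\sum_{j=1}^{k-3}jF_{n+k-2-j}^{(k)},$$ where an empty sum is $0$.
   Context: For $k\geq 2$, the $k$-th order Fibonacci numbers are defined by $F_0^{(k)}=\cdots=F_{k-2}^{(k)}=0$, $F_{k-1}^{(k)}=1$, and $F_n^{(k)}=F_{n-1}^{(k)}+F_{n-2}^{(k)}+\cdots+F_{n-k}^{(k)}$ for $n\geq k$. -}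

module Defs where

open import Data.Nat using (ℕ; zero; suc; _+_; _∸_; _≟_; _<?_)
open import Data.List using (List; []; _∷_; take)
open import Data.Nat.ListAction using (sum)
open import Data.Integer using (ℤ; +_) renaming (_+_ to _+ℤ_)
open import Relation.Nullary using (yes; no)

-- fibList k m = [F_m^(k), F_{m-1}^(k), ..., F_0^(k)]
-- F_i = 0 for i ≤ k-2, F_{k-1} = 1, F_i = F_{i-1} + ... + F_{i-k} for i ≥ k.
fibList : ℕ → ℕ → List ℕ
fibList k zero with 1 ≟ k
... | yes _ = 1 ∷ []
... | no _ = 0 ∷ []
fibList k (suc m) with suc (suc m) <? k | suc (suc m) ≟ k
... | yes _ | _ = 0 ∷ fibList k m
... | no _ | yes _ = 1 ∷ fibList k m
... | no _ | no _ = sum (take k (fibList k m)) ∷ fibList k m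

headOr0 : List ℕ → ℕ
headOr0 [] = 0
headOr0 (x ∷ _) = x

F : ℕ → ℕ → ℕ
F k n = headOr0 (fibList k n)

sumFrom : ℕ → ℕ → (ℕ → ℤ) → ℤ
sumFrom a zero f = + 0
sumFrom a (suc len) f = f a +ℤ sumFrom (suc a) len f

Σ[_to_] : ℕ → ℕ → (ℕ → ℤ) → ℤ
Σ[ a to b ] f = sumFrom a (suc b ∸ a) f

{-# OPTIONS --safe #-}
-- Every sequence f obeying the k-term recurrence f (m + k) = f m + ⋯ + f (m + k - 1) satisfies
-- the identities, so they are proved for such an f.  In (i) write L = k - t; the coefficient of
-- f m on the right is a "tent": it rises 1, 2, …, L on n - L, …, n - 1, stays at L on the
-- plateau n, …, n + t - 1, and falls L - 2, …, 1 on n + t, …, n + k - 3.  For L = 1 this is the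
-- recurrence for f (n + k - 1).  Passing from L to L + 1 shortens the plateau by f (n + t - 1):
-- L - 1 of its L copies become the new top of the falling part, and the last copy is expanded
-- by the recurrence into f (n - L - 1) + ⋯ + f (n + t - 2), raising the rising part and the
-- plateau by one.  Identity (ii) is (i) for L = k, t = 0, since the weights i and k + 1 - i
-- on f (n - i) add up to k + 1 and f (n - 1) + ⋯ + f (n - k) = f n.
module Submission where

open import Defs
open import Data.Nat using (ℕ; zero; suc; _+_; _∸_; _≤_; _<_; _*_; z≤n; s≤s; _≟_; _<?_)
open import Data.Nat.Properties
  using (≤-refl; ≤-trans; <⇒≤; <⇒≱; 1+n≰n; n≤1+n; m≤n+m; m<m+n; m<n⇒0<n∸m; +-comm; +-assoc;
         +-suc; +-identityʳ; m≤n⇒m≤1+n; m∸n≤m; +-∸-assoc; ∸-+-assoc; m+n∸n≡m; m+n∸m≡n; m∸n+n≡m; m+[n∸m]≡n; n∸n≡0)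
import Data.Nat.Tactic.RingSolver as ℕ-RingSolver
open import Data.List using ([]; _∷_; take)
open import Data.Nat.ListAction using (sum)
open import Data.Integer using (ℤ; +_) renaming (_+_ to _+ℤ_; _*_ to _*ℤ_; _-_ to _-ℤ_)
import Data.Integer.Properties as ℤ
open import Data.Integer.Tactic.RingSolver using (solve-∀)
open import Data.Product using (_×_; _,_)
open import Data.Empty using (⊥-elim)
open import Relation.Nullary using (yes; no)
open import Relation.Binary.PropositionalEquality
  using (_≡_; refl; sym; trans; cong; cong₂; subst; module ≡-Reasoning)
open ≡-Reasoning

m∸n∸o≡m∸o∸n : ∀ m n o → m ∸ n ∸ o ≡ m ∸ o ∸ n
m∸n∸o≡m∸o∸n m n o = begin
  m ∸ n ∸ o   ≡⟨ ∸-+-assoc m n o ⟩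
  m ∸ (n + o) ≡⟨ cong (m ∸_) (+-comm n o) ⟩
  m ∸ (o + n) ≡⟨ ∸-+-assoc m o n ⟨
  m ∸ o ∸ n   ∎

sumFrom-snoc : ∀ a l (f : ℕ → ℤ) → sumFrom a (suc l) f ≡ sumFrom a l f +ℤ f (a + l)
sumFrom-snoc a zero    f rewrite +-identityʳ a = ℤ.+-comm (f a) (+ 0)
sumFrom-snoc a (suc l) f rewrite sumFrom-snoc (suc a) l f | +-suc a l =
  sym (ℤ.+-assoc (f a) (sumFrom (suc a) l f) (f (suc (a + l))))

sumFrom-++ : ∀ a l₁ l₂ (f : ℕ → ℤ) →
  sumFrom a (l₁ + l₂) f ≡ sumFrom a l₁ f +ℤ sumFrom (a + l₁) l₂ f
sumFrom-++ a zero     l₂ f rewrite +-identityʳ a = sym (ℤ.+-identityˡ _)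
sumFrom-++ a (suc l₁) l₂ f rewrite sumFrom-++ (suc a) l₁ l₂ f | +-suc a l₁ =
  sym (ℤ.+-assoc (f a) (sumFrom (suc a) l₁ f) _)

sumFrom-translate : ∀ m a l (f : ℕ → ℤ) → sumFrom a l (λ i → f (m + i)) ≡ sumFrom (m + a) l f
sumFrom-translate m a zero    f = refl
sumFrom-translate m a (suc l) f = cong (f (m + a) +ℤ_) (begin
  sumFrom (suc a) l (λ i → f (m + i)) ≡⟨ sumFrom-translate m (suc a) l f ⟩
  sumFrom (m + suc a) l f             ≡⟨ cong (λ b → sumFrom b l f) (+-suc m a) ⟩
  sumFrom (suc (m + a)) l f           ∎)

sumFrom-cong : ∀ a l {f g : ℕ → ℤ} → (∀ i → a ≤ i → i < a + l → f i ≡ g i) →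
  sumFrom a l f ≡ sumFrom a l g
sumFrom-cong a zero    f≗g = refl
sumFrom-cong a (suc l) f≗g = cong₂ _+ℤ_ (f≗g a ≤-refl (m<m+n a (s≤s z≤n)))
  (sumFrom-cong (suc a) l λ i a<i i<a+1+l →
    f≗g i (≤-trans (n≤1+n a) a<i) (subst (i <_) (sym (+-suc a l)) i<a+1+l))

sumFrom-+ : ∀ a l (f g : ℕ → ℤ) →
  sumFrom a l (λ i → f i +ℤ g i) ≡ sumFrom a l f +ℤ sumFrom a l g
sumFrom-+ a zero    f g = refl
sumFrom-+ a (suc l) f g rewrite sumFrom-+ (suc a) l f g =
  interchange (f a) (g a) (sumFrom (suc a) l f) (sumFrom (suc a) l g)
  where
  interchange : ∀ x y u v → (x +ℤ y) +ℤ (u +ℤ v) ≡ (x +ℤ u) +ℤ (y +ℤ v)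
  interchange = solve-∀

sumFrom-* : ∀ a l c (f : ℕ → ℤ) → sumFrom a l (λ i → c *ℤ f i) ≡ c *ℤ sumFrom a l f
sumFrom-* a zero    c f = sym (ℤ.*-zeroʳ c)
sumFrom-* a (suc l) c f rewrite sumFrom-* (suc a) l c f = sym (ℤ.*-distribˡ-+ c (f a) _)

sumFrom-reverse : ∀ N L (f : ℕ → ℤ) → L ≤ N → sumFrom 1 L (λ i → f (N ∸ i)) ≡ sumFrom (N ∸ L) L f
sumFrom-reverse N zero    f _   = refl
sumFrom-reverse N (suc L) f L<N = begin
  sumFrom 1 (suc L) (λ i → f (N ∸ i))          ≡⟨ sumFrom-snoc 1 L (λ i → f (N ∸ i)) ⟩
  sumFrom 1 L (λ i → f (N ∸ i)) +ℤ f (N ∸ suc L)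
    ≡⟨ cong (_+ℤ f (N ∸ suc L)) (sumFrom-reverse N L f (<⇒≤ L<N)) ⟩
  sumFrom (N ∸ L) L f +ℤ f (N ∸ suc L)         ≡⟨ ℤ.+-comm _ (f (N ∸ suc L)) ⟩
  f (N ∸ suc L) +ℤ sumFrom (N ∸ L) L f
    ≡⟨ cong (λ a → f (N ∸ suc L) +ℤ sumFrom a L f) (+-∸-assoc 1 L<N) ⟩
  sumFrom (N ∸ suc L) (suc L) f                ∎

sumFrom-ramp+reversed-ramp : ∀ L (g : ℕ → ℤ) →
  sumFrom 1 L (λ i → + i *ℤ g i) +ℤ sumFrom 1 L (λ i → + (L ∸ i + 1) *ℤ g i)
    ≡ + suc L *ℤ sumFrom 1 L g
sumFrom-ramp+reversed-ramp L g = begin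
  sumFrom 1 L (λ i → + i *ℤ g i) +ℤ sumFrom 1 L (λ i → + (L ∸ i + 1) *ℤ g i)
    ≡⟨ sumFrom-+ 1 L _ _ ⟨
  sumFrom 1 L (λ i → + i *ℤ g i +ℤ + (L ∸ i + 1) *ℤ g i)
    ≡⟨ sumFrom-cong 1 L weights-add-up ⟩
  sumFrom 1 L (λ i → + suc L *ℤ g i)  ≡⟨ sumFrom-* 1 L (+ suc L) g ⟩
  + suc L *ℤ sumFrom 1 L g            ∎
  where
  weights-add-up : ∀ i → 1 ≤ i → i < 1 + L → + i *ℤ g i +ℤ + (L ∸ i + 1) *ℤ g i ≡ + suc L *ℤ g i
  weights-add-up i _ (s≤s i≤L) = begin
    + i *ℤ g i +ℤ + (L ∸ i + 1) *ℤ g i ≡⟨ ℤ.*-distribʳ-+ (g i) (+ i) (+ (L ∸ i + 1)) ⟨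
    + (i + (L ∸ i + 1)) *ℤ g i          ≡⟨ cong (λ m → + m *ℤ g i) i+[L∸i+1]≡1+L ⟩
    + suc L *ℤ g i                      ∎
    where
    i+[L∸i+1]≡1+L : i + (L ∸ i + 1) ≡ suc L
    i+[L∸i+1]≡1+L = begin
      i + (L ∸ i + 1) ≡⟨ +-assoc i (L ∸ i) 1 ⟨
      i + (L ∸ i) + 1 ≡⟨ cong (_+ 1) (m+[n∸m]≡n i≤L) ⟩
      L + 1           ≡⟨ +-comm L 1 ⟩
      suc L           ∎

Recurrent : ℕ → (ℕ → ℤ) → Set
Recurrent k f = ∀ m → f (m + k) ≡ sumFrom m k f

fibList-zero : ∀ k → fibList k 0 ≡ F k 0 ∷ []
fibList-zero k with 1 ≟ k
... | yes _ = refl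
... | no  _ = refl

fibList-suc : ∀ k m → fibList k (suc m) ≡ F k (suc m) ∷ fibList k m
fibList-suc k m with suc (suc m) <? k | suc (suc m) ≟ k
... | yes _ | _     = refl
... | no  _ | yes _ = refl
... | no  _ | no  _ = refl

F-suc : ∀ {k m} → k ≤ suc m → F k (suc m) ≡ sum (take k (fibList k m))
F-suc {k} {m} k≤1+m with suc (suc m) <? k | suc (suc m) ≟ k
... | yes 2+m<k | _         = ⊥-elim (<⇒≱ 2+m<k (≤-trans k≤1+m (n≤1+n (suc m))))
... | no  _     | yes 2+m≡k = ⊥-elim (1+n≰n (subst (_≤ suc m) (sym 2+m≡k) k≤1+m))
... | no  _     | no  _     = refl

sum-take-fibList : ∀ k m L → L ≤ suc m →
  + sum (take L (fibList k m)) ≡ sumFrom (suc m ∸ L) L (λ i → + F k i)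
sum-take-fibList k m       zero          _ = refl
sum-take-fibList k zero    (suc zero)    _ rewrite fibList-zero k = refl
sum-take-fibList k zero    (suc (suc L)) (s≤s ())
sum-take-fibList k (suc m) (suc L) (s≤s L≤1+m) rewrite fibList-suc k m = begin
  Fk (suc m) +ℤ + sum (take L (fibList k m))
    ≡⟨ cong (Fk (suc m) +ℤ_) (sum-take-fibList k m L L≤1+m) ⟩
  Fk (suc m) +ℤ sumFrom (suc m ∸ L) L Fk      ≡⟨ ℤ.+-comm (Fk (suc m)) (sumFrom (suc m ∸ L) L Fk) ⟩
  sumFrom (suc m ∸ L) L Fk +ℤ Fk (suc m)
    ≡⟨ cong (λ j → sumFrom (suc m ∸ L) L Fk +ℤ Fk j) (m∸n+n≡m L≤1+m) ⟨
  sumFrom (suc m ∸ L) L Fk +ℤ Fk (suc m ∸ L + L) ≡⟨ sumFrom-snoc (suc m ∸ L) L Fk ⟨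
  sumFrom (suc m ∸ L) (suc L) Fk              ∎
  where
  Fk : ℕ → ℤ
  Fk i = + F k i

F-recurrent : ∀ k → Recurrent k (λ m → + F k m)
F-recurrent zero    m = cong +_ (F₀≡0 (m + 0))
  where
  F₀≡0 : ∀ j → F 0 j ≡ 0
  F₀≡0 zero    = refl
  F₀≡0 (suc j) = F-suc {m = j} z≤n
F-recurrent (suc k) m = begin
  + F (suc k) (m + suc k)                           ≡⟨ cong (λ j → + F (suc k) j) (+-suc m k) ⟩
  + F (suc k) (suc (m + k))                         ≡⟨ cong +_ (F-suc (s≤s (m≤n+m k m))) ⟩
  + sum (take (suc k) (fibList (suc k) (m + k)))    ≡⟨ sum-take-fibList (suc k) (m + k) (suc k) (s≤s (m≤n+m k m)) ⟩
  sumFrom (m + k ∸ k) (suc k) (λ i → + F (suc k) i) ≡⟨ cong (λ a → sumFrom a (suc k) (λ i → + F (suc k) i)) (m+n∸n≡m m k) ⟩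
  sumFrom m (suc k) (λ i → + F (suc k) i)           ∎

module _ {k : ℕ} (f : ℕ → ℤ) (n : ℕ) where

  falling : ℕ → ℤ
  falling D = sumFrom 1 D (λ j → + j *ℤ f (n + k ∸ 2 ∸ j))

  plateau : ℕ → ℤ
  plateau t = sumFrom 0 t (λ s → f (n + s))

  rising : ℕ → ℤ
  rising L = sumFrom 1 L (λ i → + (L ∸ i + 1) *ℤ f (n ∸ i))

  falling-snoc : ∀ l t → 2 + l + t ≡ k → falling l ≡ falling (l ∸ 1) +ℤ + l *ℤ f (n + t)
  falling-snoc zero    t _    = refl
  falling-snoc (suc l) t refl = begin
    falling (suc l)                                   ≡⟨ sumFrom-snoc 1 l _ ⟩
    falling l +ℤ + suc l *ℤ f (n + k ∸ 2 ∸ suc l)     ≡⟨ cong (λ m → falling l +ℤ + suc l *ℤ f m) top-index ⟩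
    falling l +ℤ + suc l *ℤ f (n + t)                 ∎
    where
    top-index : n + (3 + l + t) ∸ 2 ∸ suc l ≡ n + t
    top-index = begin
      n + (3 + l + t) ∸ 2 ∸ suc l       ≡⟨ cong (λ m → m ∸ 2 ∸ suc l) (reassociate n l t) ⟩
      2 + (suc l + (n + t)) ∸ 2 ∸ suc l ≡⟨ m+n∸m≡n (suc l) (n + t) ⟩
      n + t                             ∎
      where
      reassociate : ∀ n l t → n + (3 + l + t) ≡ 2 + ((1 + l) + (n + t))
      reassociate = ℕ-RingSolver.solve-∀

  rising-suc : ∀ L → rising (suc L) ≡ rising L +ℤ sumFrom 1 (suc L) (λ i → f (n ∸ i))
  rising-suc L = begin
    rising (suc L)                                          ≡⟨ sumFrom-snoc 1 L w ⟩
    sumFrom 1 L w +ℤ w (suc L)                              ≡⟨ cong₂ _+ℤ_ (sumFrom-cong 1 L w-suc) w-top ⟩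
    sumFrom 1 L (λ i → + (L ∸ i + 1) *ℤ g i +ℤ g i) +ℤ g (suc L) ≡⟨ cong (_+ℤ g (suc L)) (sumFrom-+ 1 L _ g) ⟩
    rising L +ℤ sumFrom 1 L g +ℤ g (suc L)                  ≡⟨ ℤ.+-assoc (rising L) _ _ ⟩
    rising L +ℤ (sumFrom 1 L g +ℤ g (suc L))                ≡⟨ cong (rising L +ℤ_) (sumFrom-snoc 1 L g) ⟨
    rising L +ℤ sumFrom 1 (suc L) g                         ∎
    where
    g : ℕ → ℤ
    g i = f (n ∸ i)
    w : ℕ → ℤ
    w i = + (suc L ∸ i + 1) *ℤ g i
    w-suc : ∀ i → 1 ≤ i → i < 1 + L → w i ≡ + (L ∸ i + 1) *ℤ g i +ℤ g i
    w-suc i _ (s≤s i≤L) = begin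
      + (suc L ∸ i + 1) *ℤ g i    ≡⟨ cong (λ m → + (m + 1) *ℤ g i) (+-∸-assoc 1 i≤L) ⟩
      + suc (L ∸ i + 1) *ℤ g i    ≡⟨ ℤ.suc-* (+ (L ∸ i + 1)) (g i) ⟩
      g i +ℤ + (L ∸ i + 1) *ℤ g i ≡⟨ ℤ.+-comm (g i) _ ⟩
      + (L ∸ i + 1) *ℤ g i +ℤ g i ∎
    w-top : w (suc L) ≡ g (suc L)
    w-top = trans (cong (λ m → + (m + 1) *ℤ g (suc L)) (n∸n≡0 L)) (ℤ.*-identityˡ (g (suc L)))

  module _ (rec : Recurrent k f) where

    recurrence-split : ∀ {L t} → L + t ≡ k → L ≤ n → f (n + t) ≡ sumFrom 1 L (λ i → f (n ∸ i)) +ℤ plateau t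
    recurrence-split {L} {t} refl L≤n = begin
      f (n + t)                                        ≡⟨ cong f n+t≡n∸L+[L+t] ⟩
      f (n ∸ L + (L + t))                              ≡⟨ rec (n ∸ L) ⟩
      sumFrom (n ∸ L) (L + t) f                        ≡⟨ sumFrom-++ (n ∸ L) L t f ⟩
      sumFrom (n ∸ L) L f +ℤ sumFrom (n ∸ L + L) t f   ≡⟨ cong₂ _+ℤ_ (sumFrom-reverse n L f L≤n) plateau-from-n ⟨
      sumFrom 1 L (λ i → f (n ∸ i)) +ℤ plateau t       ∎
      where
      n+t≡n∸L+[L+t] : n + t ≡ n ∸ L + (L + t)
      n+t≡n∸L+[L+t] = trans (cong (_+ t) (sym (m∸n+n≡m L≤n))) (+-assoc (n ∸ L) L t)
      plateau-from-n : plateau t ≡ sumFrom (n ∸ L + L) t f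
      plateau-from-n = trans (sumFrom-translate n 0 t f)
        (cong (λ a → sumFrom a t f) (trans (+-identityʳ n) (sym (m∸n+n≡m L≤n))))

    tent-identity : ∀ L t → L + t ≡ k → 1 ≤ L → L ≤ n →
      f (n + k ∸ 1) ≡ falling (L ∸ 2) +ℤ + L *ℤ plateau t +ℤ rising L
    tent-identity (suc zero) t L+t≡k _ L≤n = begin
      f (n + k ∸ 1)                                  ≡⟨ cong f n+k∸1≡n+t ⟩
      f (n + t)                                      ≡⟨ recurrence-split L+t≡k L≤n ⟩
      sumFrom 1 1 (λ i → f (n ∸ i)) +ℤ plateau t     ≡⟨ regroup (f (n ∸ 1)) (plateau t) ⟩
      falling 0 +ℤ + 1 *ℤ plateau t +ℤ rising 1      ∎
      where
      n+k∸1≡n+t : n + k ∸ 1 ≡ n + t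
      n+k∸1≡n+t = cong (_∸ 1) (trans (cong (λ m → n + m) (sym L+t≡k)) (+-suc n t))
      regroup : ∀ x P → (x +ℤ + 0) +ℤ P ≡ + 0 +ℤ + 1 *ℤ P +ℤ (+ 1 *ℤ x +ℤ + 0)
      regroup = solve-∀
    tent-identity (suc (suc l)) t L+t≡k _ L≤n = begin
      f (n + k ∸ 1)
        ≡⟨ tent-identity (suc l) (suc t) (trans (+-suc (suc l) t) L+t≡k) (s≤s z≤n) (≤-trans (n≤1+n _) L≤n) ⟩
      falling (l ∸ 1) +ℤ + suc l *ℤ plateau (suc t) +ℤ rising (suc l)
        ≡⟨ cong (λ p → falling (l ∸ 1) +ℤ + suc l *ℤ p +ℤ rising (suc l)) plateau-suc ⟩
      falling (l ∸ 1) +ℤ + suc l *ℤ (P +ℤ (W +ℤ P)) +ℤ rising (suc l)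
        ≡⟨ move-top-copy (falling (l ∸ 1)) P W (rising (suc l)) (+ l) ⟩
      (falling (l ∸ 1) +ℤ + l *ℤ (W +ℤ P)) +ℤ + suc (suc l) *ℤ P +ℤ (rising (suc l) +ℤ W)
        ≡⟨ cong₂ (λ a b → a +ℤ + suc (suc l) *ℤ P +ℤ b) falling-suc (rising-suc (suc l)) ⟨
      falling l +ℤ + suc (suc l) *ℤ P +ℤ rising (suc (suc l))
        ∎
      where
      P W : ℤ
      P = plateau t
      W = sumFrom 1 (suc (suc l)) (λ i → f (n ∸ i))
      top : f (n + t) ≡ W +ℤ P
      top = recurrence-split L+t≡k L≤n
      plateau-suc : plateau (suc t) ≡ P +ℤ (W +ℤ P)
      plateau-suc = trans (sumFrom-snoc 0 t (λ s → f (n + s))) (cong (P +ℤ_) top)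
      falling-suc : falling l ≡ falling (l ∸ 1) +ℤ + l *ℤ (W +ℤ P)
      falling-suc = trans (falling-snoc l t L+t≡k) (cong (λ x → falling (l ∸ 1) +ℤ + l *ℤ x) top)
      move-top-copy : ∀ A P W R l → A +ℤ (+ 1 +ℤ l) *ℤ (P +ℤ (W +ℤ P)) +ℤ R
                        ≡ (A +ℤ l *ℤ (W +ℤ P)) +ℤ (+ 1 +ℤ (+ 1 +ℤ l)) *ℤ P +ℤ (R +ℤ W)
      move-top-copy = solve-∀

    tent-identity-by-plateau : ∀ t → t < k → k ≤ n →
      f (n + k ∸ 1) ≡ falling (k ∸ (t + 2)) +ℤ + (k ∸ t) *ℤ plateau t
                        +ℤ sumFrom 1 (k ∸ t) (λ i → + (k ∸ i ∸ t + 1) *ℤ f (n ∸ i))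
    tent-identity-by-plateau t t<k k≤n = begin
      f (n + k ∸ 1)
        ≡⟨ tent-identity (k ∸ t) t (m∸n+n≡m (<⇒≤ t<k)) (m<n⇒0<n∸m t<k) (≤-trans (m∸n≤m k t) k≤n) ⟩
      falling (k ∸ t ∸ 2) +ℤ + (k ∸ t) *ℤ plateau t +ℤ rising (k ∸ t)
        ≡⟨ cong₂ (λ D r → falling D +ℤ + (k ∸ t) *ℤ plateau t +ℤ r) (∸-+-assoc k t 2)
             (sumFrom-cong 1 (k ∸ t) λ i _ _ → cong (λ c → + (c + 1) *ℤ f (n ∸ i)) (m∸n∸o≡m∸o∸n k t i)) ⟩
      falling (k ∸ (t + 2)) +ℤ + (k ∸ t) *ℤ plateau t
        +ℤ sumFrom 1 (k ∸ t) (λ i → + (k ∸ i ∸ t + 1) *ℤ f (n ∸ i)) ∎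

    ramp-identity : 2 ≤ k → k ≤ n →
      sumFrom 1 k (λ i → + i *ℤ f (n ∸ i)) ≡ (+ (2 * k ∸ 1) *ℤ f n -ℤ f (n + k ∸ 1)) +ℤ falling (k ∸ 3)
    ramp-identity (s≤s (s≤s {n = j} z≤n)) k≤n = begin
      S                                                 ≡⟨ add-sub S R ⟩
      (S +ℤ R) -ℤ R                                     ≡⟨ cong (_-ℤ R) (sumFrom-ramp+reversed-ramp k g) ⟩
      + suc k *ℤ G -ℤ R                                 ≡⟨ regroup G R A (+ j) ⟩
      (+ (suc k + j) *ℤ (G +ℤ + 0) -ℤ top) +ℤ A         ≡⟨ cong₂ (λ c x → (+ c *ℤ x -ℤ top) +ℤ A) 2k∸1≡1+k+j fn ⟨
      (+ (2 * k ∸ 1) *ℤ f n -ℤ top) +ℤ A                ≡⟨ cong (λ y → (+ (2 * k ∸ 1) *ℤ f n -ℤ y) +ℤ A) tent ⟨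
      (+ (2 * k ∸ 1) *ℤ f n -ℤ f (n + k ∸ 1)) +ℤ A      ∎
      where
      g : ℕ → ℤ
      g i = f (n ∸ i)
      S G R A top : ℤ
      S = sumFrom 1 k (λ i → + i *ℤ g i)
      G = sumFrom 1 k g
      R = rising k
      A = falling (j ∸ 1)
      top = A +ℤ + j *ℤ (G +ℤ + 0) +ℤ + k *ℤ + 0 +ℤ R
      fn+0 : f (n + 0) ≡ G +ℤ + 0
      fn+0 = recurrence-split (+-identityʳ k) k≤n
      fn : f n ≡ G +ℤ + 0
      fn = trans (cong f (sym (+-identityʳ n))) fn+0
      tent : f (n + k ∸ 1) ≡ top
      tent = trans (tent-identity k 0 (+-identityʳ k) (s≤s z≤n) k≤n)
        (cong (λ a → a +ℤ + k *ℤ + 0 +ℤ R)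
          (trans (falling-snoc j 0 (+-identityʳ k)) (cong (λ x → A +ℤ + j *ℤ x) fn+0)))
      2k∸1≡1+k+j : 2 * k ∸ 1 ≡ suc k + j
      2k∸1≡1+k+j = cong (_∸ 1) (double j)
        where
        double : ∀ j → 2 * (2 + j) ≡ 1 + (3 + j + j)
        double = ℕ-RingSolver.solve-∀
      add-sub : ∀ S R → S ≡ (S +ℤ R) -ℤ R
      add-sub = solve-∀
      regroup : ∀ G R A κ → (+ 1 +ℤ (+ 1 +ℤ (+ 1 +ℤ κ))) *ℤ G -ℤ R
        ≡ ((+ 1 +ℤ (+ 1 +ℤ (+ 1 +ℤ κ))) +ℤ κ) *ℤ (G +ℤ + 0)
            -ℤ ((A +ℤ κ *ℤ (G +ℤ + 0)) +ℤ (+ 1 +ℤ (+ 1 +ℤ κ)) *ℤ + 0 +ℤ R) +ℤ A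
      regroup = solve-∀

lemma3p3 : (n k : ℕ) → k ≤ n →
    ((4 ≤ k → (t : ℕ) → 1 ≤ t → t ≤ k ∸ 2 →
      + F k (n + k ∸ 1) ≡
        (Σ[ 1 to k ∸ (t + 2) ] (λ j → + j *ℤ + F k (n + k ∸ 2 ∸ j)))
        +ℤ (+ (k ∸ t) *ℤ Σ[ 0 to t ∸ 1 ] (λ s → + F k (n + s)))
        +ℤ Σ[ 1 to k ∸ t ] (λ i → + (k ∸ i ∸ t + 1) *ℤ + F k (n ∸ i)))
    ×
    (2 ≤ k →
      Σ[ 1 to k ] (λ i → + i *ℤ + F k (n ∸ i)) ≡
        ((+ (2 * k ∸ 1) *ℤ + F k n) -ℤ + F k (n + k ∸ 1))
        +ℤ Σ[ 1 to k ∸ 3 ] (λ j → + j *ℤ + F k (n + k ∸ 2 ∸ j))))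
lemma3p3 n k k≤n = part-i , λ 2≤k → ramp-identity Fk n (F-recurrent k) 2≤k k≤n
  where
  Fk : ℕ → ℤ
  Fk m = + F k m
  part-i : 4 ≤ k → (t : ℕ) → 1 ≤ t → t ≤ k ∸ 2 →
    Fk (n + k ∸ 1) ≡
      (Σ[ 1 to k ∸ (t + 2) ] (λ j → + j *ℤ Fk (n + k ∸ 2 ∸ j)))
      +ℤ (+ (k ∸ t) *ℤ Σ[ 0 to t ∸ 1 ] (λ s → Fk (n + s)))
      +ℤ Σ[ 1 to k ∸ t ] (λ i → + (k ∸ i ∸ t + 1) *ℤ Fk (n ∸ i))
  part-i (s≤s (s≤s _)) t@(suc _) _ t≤k∸2 =
    tent-identity-by-plateau Fk n (F-recurrent k) t (s≤s (m≤n⇒m≤1+n t≤k∸2)) k≤n
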